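{- If a $k$-uniform hypergraph contains no non-self-intersecting semicycle as a subhypergraph, then it contains no semicycle as a subhypergraph (i.e. it is semicycle-free).
   Context: Hypergraphs are finite, $k$-uniform and have no multiple edges. A nonempty $k$-uniform hypergraph $\mathcal{C}$ is a semicycle if there is a sequence $v_1,\dots,v_l$ of its vertices in which every vertex of $\mathcal{C}$ appears at least once (possibly several times), $v_1=v_l$, and the sets $\{v_i,\dots,v_{i+k-1}\}$ for $1\le i\le l-k+1$ are pairwise distinct edges of $\mathcal{C}$ and are exactly the edges of $\mathcal{C}$. A semicycle is non-self-intersecting if in its defining sequence no vertex appears twice apart from the required coincidence $v_1=v_l$. -}

module Defs where

open import Data.Nat using (ℕ; _≤?_)
open import Data.Fin using (Fin)
open import Data.Fin.Subset as S using (Subset; ⁅_⁆; _∪_; ∣_∣)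
open import Data.List using (List; []; _∷_; length; take; foldr)
open import Data.List.Relation.Unary.All using (All)
open import Data.List.Relation.Unary.Unique.Propositional using (Unique)
import Data.List.Membership.Propositional as LM
open import Data.Product using (Σ; _×_)
open import Relation.Binary.PropositionalEquality using (_≡_; _≢_)
open import Relation.Nullary using (yes; no)
open import Function.Bundles using (_⇔_)

record Hypergraph (n k : ℕ) : Set where
  field
    vertices : Subset n
    edges    : List (Subset n)
    edges-unique  : Unique edges
    edges-uniform : All (λ e → ∣ e ∣ ≡ k) edges
    edges-in      : All (λ e → e S.⊆ vertices) edges
open Hypergraph public

_⊑_ : ∀ {n k} → Hypergraph n k → Hypergraph n k → Set
C ⊑ H = (vertices C S.⊆ vertices H)
      × (∀ e → e LM.∈ edges C → e LM.∈ edges H)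

toSet : ∀ {n} → List (Fin n) → Subset n
toSet = foldr (λ v s → ⁅ v ⁆ ∪ s) S.⊥

windows : ∀ {n} → ℕ → List (Fin n) → List (Subset n)
windows k [] = []
windows k (x ∷ xs) with k ≤? length (x ∷ xs)
... | yes _ = toSet (take k (x ∷ xs)) ∷ windows k xs
... | no  _ = []

lastOf : ∀ {A : Set} → A → List A → A
lastOf a [] = a
lastOf a (b ∷ xs) = lastOf b xs

initOf : ∀ {A : Set} → A → List A → List A
initOf a [] = []
initOf a (b ∷ xs) = a ∷ initOf b xs

-- The nonempty sequence v₁ = v , v₂ … v_l = rest is a defining sequence of C:
-- it consists of vertices of C, every vertex of C occurs, v₁ = v_l, the
-- windows are pairwise distinct and are exactly the edges of C.
IsDefiningSeq : ∀ {n k} → Hypergraph n k → Fin n → List (Fin n) → Set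
IsDefiningSeq {n} {k} C v rest =
    All (λ u → u S.∈ vertices C) (v ∷ rest)
  × (∀ u → u S.∈ vertices C → u LM.∈ (v ∷ rest))
  × (lastOf v rest ≡ v)
  × Unique (windows k (v ∷ rest))
  × (∀ e → (e LM.∈ edges C) ⇔ (e LM.∈ windows k (v ∷ rest)))

NonEmpty : ∀ {n k} → Hypergraph n k → Set
NonEmpty C = edges C ≢ []

IsSemicycle : ∀ {n k} → Hypergraph n k → Set
IsSemicycle {n} C =
  NonEmpty C × Σ (Fin n) λ v → Σ (List (Fin n)) λ rest → IsDefiningSeq C v rest

-- non-self-intersecting: some defining sequence has no repeated vertex
-- apart from v₁ = v_l
IsNSISemicycle : ∀ {n k} → Hypergraph n k → Set
IsNSISemicycle {n} C =
  NonEmpty C × Σ (Fin n) λ v → Σ (List (Fin n)) λ rest →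
    IsDefiningSeq C v rest × Unique (initOf v rest)

ContainsSemicycle : ∀ {n k} → Hypergraph n k → Set
ContainsSemicycle {n} {k} H = Σ (Hypergraph n k) λ C → C ⊑ H × IsSemicycle C

ContainsNSISemicycle : ∀ {n k} → Hypergraph n k → Set
ContainsNSISemicycle {n} {k} H = Σ (Hypergraph n k) λ C → C ⊑ H × IsNSISemicycle C

-- Take a defining sequence of a semicycle. If its vertices v₁ … v_{l-1} are
-- pairwise distinct it already witnesses non-self-intersection. Otherwise
-- choose a repetition x … x whose inner part repeats nothing; this closed
-- stretch is itself a non-self-intersecting semicycle. Its windows are a
-- contiguous block of the windows of the whole sequence, hence distinct edges
-- of the original semicycle. There is at least one window: were the stretch
-- shorter than k, it would lie inside a window of the whole sequence, and the
-- repeated x would leave that window with fewer than k vertices.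
module Submission where

open import Defs
open import Data.Nat using (ℕ; zero; suc; _≤_; _<_; _≤?_; _∸_; z≤n; s≤s)
open import Data.Nat.Properties
  using (≤-trans; ≤-refl; ≤-reflexive; ≰⇒>; <⇒≤; ≤-antisym; <-irrefl; m≤n⇒m≤1+n; m⊓n≤m)
open import Data.Fin using (Fin; zero; suc; _≟_)
open import Data.Fin.Subset as S using (Subset; ⁅_⁆; _∪_; ∣_∣; inside; outside)
open import Data.Fin.Subset.Properties
  using (x∈p∪q⁻; x∈p∪q⁺; x∈⁅y⁆⇒x≡y; x∈⁅x⁆; ∉⊥; q⊆p∪q; ⊆-antisym; ∪-identityˡ; ∣p∣≤∣x∷p∣; ∣⊥∣≡0)
open import Data.Vec using (_∷_)
open import Data.List using (List; []; _∷_; length; take; _++_; [_])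
open import Data.List.Properties using (++-assoc; take-all; take++drop≡id; length-take)
open import Data.List.Relation.Unary.All as All using (All; []; _∷_)
open import Data.List.Relation.Unary.All.Properties using (¬Any⇒All¬)
import Data.List.Relation.Unary.All.Properties as Allₚ
open import Data.List.Relation.Unary.Any using (here; there)
open import Data.List.Relation.Unary.AllPairs using ([]; _∷_)
open import Data.List.Relation.Unary.Unique.Propositional using (Unique)
open import Data.List.Membership.Propositional using (_∈_; _∉_)
open import Data.List.Membership.Propositional.Properties using (∈-∃++; ∈-++⁺ˡ; ∈-++⁺ʳ; ∈-insert)
import Data.List.Membership.DecPropositional as DecMembership
open import Data.Product using (_×_; _,_; proj₁; proj₂; ∃; ∃₂)
open import Data.Sum using (_⊎_; inj₁; inj₂)
open import Data.Empty using (⊥-elim)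
open import Relation.Nullary using (¬_; yes; no)
open import Relation.Binary.Definitions using (DecidableEquality)
open import Relation.Binary.PropositionalEquality
  using (_≡_; refl; sym; trans; cong; cong₂; subst; module ≡-Reasoning)
open import Function.Bundles using (_⇔_; mk⇔; Equivalence)

private variable
  n k : ℕ
  A : Set

length-prefix-≤ : (xs ys : List A) → length xs ≤ length (xs ++ ys)
length-prefix-≤ []       ys = z≤n
length-prefix-≤ (x ∷ xs) ys = s≤s (length-prefix-≤ xs ys)

length-suffix-≤ : (xs ys : List A) → length ys ≤ length (xs ++ ys)
length-suffix-≤ []       ys = ≤-refl
length-suffix-≤ (x ∷ xs) ys = m≤n⇒m≤1+n (length-suffix-≤ xs ys)

take-++ˡ : ∀ k (xs ys : List A) → k ≤ length xs → take k (xs ++ ys) ≡ take k xs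
take-++ˡ zero    xs       ys _         = refl
take-++ˡ (suc k) (x ∷ xs) ys (s≤s k≤) = cong (x ∷_) (take-++ˡ k xs ys k≤)

take-++ʳ : ∀ k (xs ys : List A) → length xs ≤ k →
           take k (xs ++ ys) ≡ xs ++ take (k ∸ length xs) ys
take-++ʳ k       []       ys _         = refl
take-++ʳ (suc k) (x ∷ xs) ys (s≤s ≤k) = cong (x ∷_) (take-++ʳ k xs ys ≤k)

≢[]⇒∃∈ : {xs : List A} → ¬ xs ≡ [] → ∃ (_∈ xs)
≢[]⇒∃∈ {xs = []}     xs≢[] = ⊥-elim (xs≢[] refl)
≢[]⇒∃∈ {xs = x ∷ xs} _     = x , here refl

∈-take⁻ : ∀ k {x : A} xs → x ∈ take k xs → x ∈ xs
∈-take⁻ k {x} xs x∈ = subst (x ∈_) (take++drop≡id k xs) (∈-++⁺ˡ x∈)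

Unique-++⁻ˡ : (xs : List A) {ys : List A} → Unique (xs ++ ys) → Unique xs
Unique-++⁻ˡ []       _          = []
Unique-++⁻ˡ (x ∷ xs) (x∉ ∷ xs!) = Allₚ.++⁻ˡ xs x∉ ∷ Unique-++⁻ˡ xs xs!

Unique-++⁻ʳ : (xs : List A) {ys : List A} → Unique (xs ++ ys) → Unique ys
Unique-++⁻ʳ []       ys! = ys!
Unique-++⁻ʳ (x ∷ xs) (_ ∷ xs!) = Unique-++⁻ʳ xs xs!

Unique[xs++x∷ys]⇒x∉xs : (xs : List A) {x : A} {ys : List A} →
                        Unique (xs ++ x ∷ ys) → x ∉ xs
Unique[xs++x∷ys]⇒x∉xs (y ∷ xs) (y∉ ∷ _)  (here refl) = All.lookup y∉ (∈-insert xs) refl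
Unique[xs++x∷ys]⇒x∉xs (y ∷ xs) (_ ∷ xs!) (there x∈) = Unique[xs++x∷ys]⇒x∉xs xs xs! x∈

∷≡initOf++[lastOf] : (x : A) (xs : List A) → x ∷ xs ≡ initOf x xs ++ [ lastOf x xs ]
∷≡initOf++[lastOf] x []       = refl
∷≡initOf++[lastOf] x (y ∷ xs) = cong (x ∷_) (∷≡initOf++[lastOf] y xs)

initOf-snoc : (x : A) (xs : List A) (y : A) → initOf x (xs ++ [ y ]) ≡ x ∷ xs
initOf-snoc x []       y = refl
initOf-snoc x (z ∷ xs) y = cong (x ∷_) (initOf-snoc z xs y)

lastOf-snoc : (x : A) (xs : List A) (y : A) → lastOf x (xs ++ [ y ]) ≡ y
lastOf-snoc x []       y = refl
lastOf-snoc x (z ∷ xs) y = lastOf-snoc z xs y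

record SimpleLoop (xs : List A) : Set where
  field
    before : List A
    base   : A
    inner  : List A
    after  : List A
    split  : xs ≡ before ++ (base ∷ inner ++ [ base ]) ++ after
    simple : Unique (base ∷ inner)

module _ (_≟ᴬ_ : DecidableEquality A) where
  open DecMembership _≟ᴬ_ using (_∈?_)

  unique⊎simpleLoop : (xs : List A) → Unique xs ⊎ SimpleLoop xs
  unique⊎simpleLoop []       = inj₁ []
  unique⊎simpleLoop (x ∷ xs) with unique⊎simpleLoop xs
  ... | inj₂ loop = inj₂ record
    { before = x ∷ before ; base = base ; inner = inner ; after = after
    ; split = cong (x ∷_) split ; simple = simple }
    where open SimpleLoop loop
  ... | inj₁ xs! with x ∈? xs
  ...   | no x∉xs = inj₁ (¬Any⇒All¬ xs x∉xs ∷ xs!)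
  ...   | yes x∈xs with ∈-∃++ x∈xs
  ...     | inner , after , refl = inj₂ record
    { before = []
    ; base   = x
    ; inner  = inner
    ; after  = after
    ; split  = cong (x ∷_) (sym (++-assoc inner [ x ] after))
    ; simple = ¬Any⇒All¬ inner (Unique[xs++x∷ys]⇒x∉xs inner xs!) ∷ Unique-++⁻ˡ inner xs!
    }

∈-toSet⁺ : {u : Fin n} {xs : List (Fin n)} → u ∈ xs → u S.∈ toSet xs
∈-toSet⁺ (here refl) = x∈p∪q⁺ (inj₁ (x∈⁅x⁆ _))
∈-toSet⁺ (there u∈)  = x∈p∪q⁺ (inj₂ (∈-toSet⁺ u∈))

∈-toSet⁻ : {u : Fin n} (xs : List (Fin n)) → u S.∈ toSet xs → u ∈ xs
∈-toSet⁻ []       u∈ = ⊥-elim (∉⊥ u∈)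
∈-toSet⁻ (x ∷ xs) u∈ with x∈p∪q⁻ ⁅ x ⁆ (toSet xs) u∈
... | inj₁ u∈⁅x⁆ = here (x∈⁅y⁆⇒x≡y x u∈⁅x⁆)
... | inj₂ u∈xs  = there (∈-toSet⁻ xs u∈xs)

∣⁅x⁆∪p∣≤1+∣p∣ : (x : Fin n) (p : Subset n) → ∣ ⁅ x ⁆ ∪ p ∣ ≤ suc ∣ p ∣
∣⁅x⁆∪p∣≤1+∣p∣ zero    (b ∷ p) rewrite ∪-identityˡ p = s≤s (∣p∣≤∣x∷p∣ b p)
∣⁅x⁆∪p∣≤1+∣p∣ (suc x) (outside ∷ p) = ∣⁅x⁆∪p∣≤1+∣p∣ x p
∣⁅x⁆∪p∣≤1+∣p∣ (suc x) (inside ∷ p)  = s≤s (∣⁅x⁆∪p∣≤1+∣p∣ x p)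

x∈p⇒⁅x⁆∪p≡p : {x : Fin n} {p : Subset n} → x S.∈ p → ⁅ x ⁆ ∪ p ≡ p
x∈p⇒⁅x⁆∪p≡p {x = x} {p} x∈p = ⊆-antisym ⁅x⁆∪p⊆p (q⊆p∪q ⁅ x ⁆ p)
  where
  ⁅x⁆∪p⊆p : ⁅ x ⁆ ∪ p S.⊆ p
  ⁅x⁆∪p⊆p y∈ with x∈p∪q⁻ ⁅ x ⁆ p y∈
  ... | inj₁ y∈⁅x⁆ rewrite x∈⁅y⁆⇒x≡y x y∈⁅x⁆ = x∈p
  ... | inj₂ y∈p   = y∈p

∣toSet∣≤length : (xs : List (Fin n)) → ∣ toSet xs ∣ ≤ length xs
∣toSet∣≤length {n} []       = ≤-reflexive (∣⊥∣≡0 n)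
∣toSet∣≤length     (x ∷ xs) = ≤-trans (∣⁅x⁆∪p∣≤1+∣p∣ x (toSet xs)) (s≤s (∣toSet∣≤length xs))

∣toSet∣<length : (xs : List (Fin n)) {x : Fin n} (ys : List (Fin n)) →
                 x ∈ ys → ∣ toSet (xs ++ x ∷ ys) ∣ < length (xs ++ x ∷ ys)
∣toSet∣<length []       ys x∈ys rewrite x∈p⇒⁅x⁆∪p≡p (∈-toSet⁺ x∈ys) = s≤s (∣toSet∣≤length ys)
∣toSet∣<length (y ∷ xs) ys x∈ys =
  ≤-trans (s≤s (∣⁅x⁆∪p∣≤1+∣p∣ y _)) (s≤s (∣toSet∣<length xs ys x∈ys))

windows-∷ : {x : Fin n} {xs : List (Fin n)} → k ≤ length (x ∷ xs) →
            windows k (x ∷ xs) ≡ toSet (take k (x ∷ xs)) ∷ windows k xs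
windows-∷ {k = k} {x = x} {xs} k≤ with k ≤? length (x ∷ xs)
... | yes _  = refl
... | no k≰ = ⊥-elim (k≰ k≤)

windows-short : (xs : List (Fin n)) → length xs < k → windows k xs ≡ []
windows-short         []       _     = refl
windows-short {k = k} (x ∷ xs) <k with k ≤? length (x ∷ xs)
... | yes k≤ = ⊥-elim (<-irrefl refl (≤-trans <k k≤))
... | no _   = refl

∈-windows⇒k≤length : {e : Subset n} (xs : List (Fin n)) → e ∈ windows k xs → k ≤ length xs
∈-windows⇒k≤length {k = k} (x ∷ xs) e∈ with k ≤? length (x ∷ xs)
... | yes k≤ = k≤

∈-windows⇒⊆toSet : {e : Subset n} (xs : List (Fin n)) → e ∈ windows k xs → e S.⊆ toSet xs
∈-windows⇒⊆toSet {k = k} (x ∷ xs) e∈ u∈ with k ≤? length (x ∷ xs)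
∈-windows⇒⊆toSet {k = k} (x ∷ xs) (here refl) u∈ | yes _ =
  ∈-toSet⁺ (∈-take⁻ k (x ∷ xs) (∈-toSet⁻ _ u∈))
∈-windows⇒⊆toSet {k = k} (x ∷ xs) (there e∈) u∈ | yes _ =
  q⊆p∪q ⁅ x ⁆ _ (∈-windows⇒⊆toSet xs e∈ u∈)

windows-++-suffix : (xs ys : List (Fin n)) →
                    ∃ λ P → windows k (xs ++ ys) ≡ P ++ windows k ys
windows-++-suffix         []       ys = [] , refl
windows-++-suffix {k = k} (x ∷ xs) ys with k ≤? length (x ∷ xs ++ ys)
... | yes _ =
  let w = toSet (take k (x ∷ xs ++ ys)); P , eq = windows-++-suffix xs ys
  in  w ∷ P , cong (w ∷_) eq
... | no k≰ =
  [] , sym (windows-short ys (≤-trans (s≤s (length-suffix-≤ xs ys)) (<⇒≤ (≰⇒> k≰))))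

windows-++-prefix : (xs ys : List (Fin n)) →
                    ∃ λ Q → windows k (xs ++ ys) ≡ windows k xs ++ Q
windows-++-prefix         []       ys = _ , refl
windows-++-prefix {k = k} (x ∷ xs) ys with k ≤? length (x ∷ xs)
... | no _   = _ , refl
... | yes k≤ =
  let Q , eq = windows-++-prefix xs ys in
  Q , trans (windows-∷ (≤-trans k≤ (length-prefix-≤ (x ∷ xs) ys)))
            (cong₂ _∷_ (cong toSet (take-++ˡ k (x ∷ xs) ys k≤)) eq)

windows-++-infix : (xs ys zs : List (Fin n)) →
                   ∃₂ λ P Q → windows k (xs ++ ys ++ zs) ≡ P ++ windows k ys ++ Q
windows-++-infix xs ys zs =
  let P , eq₁ = windows-++-suffix xs (ys ++ zs)
      Q , eq₂ = windows-++-prefix ys zs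
  in  P , Q , trans eq₁ (cong (P ++_) eq₂)

window-⊇-short-infix :
  (xs : List (Fin n)) (y : Fin n) (ys zs : List (Fin n)) →
  length (y ∷ ys) ≤ k → k ≤ length (xs ++ y ∷ ys ++ zs) →
  ∃ λ L → toSet L ∈ windows k (xs ++ y ∷ ys ++ zs) × length L ≤ k ×
          ∃₂ λ p q → L ≡ p ++ y ∷ ys ++ q
window-⊇-short-infix {k = k} [] y ys zs short k≤ =
  take k (y ∷ ys ++ zs) , subst (toSet (take k (y ∷ ys ++ zs)) ∈_) (sym (windows-∷ k≤)) (here refl) ,
  ≤-trans (≤-reflexive (length-take k _)) (m⊓n≤m k _) ,
  [] , _ , take-++ʳ k (y ∷ ys) zs short
window-⊇-short-infix {k = k} (x ∷ xs) y ys zs short k≤ with k ≤? length (xs ++ y ∷ ys ++ zs)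
... | yes k≤′ =
  let L , L∈ , L≤k , split = window-⊇-short-infix xs y ys zs short k≤′
  in  L , subst (_ ∈_) (sym (windows-∷ k≤)) (there L∈) , L≤k , split
... | no k≰′ =
  x ∷ xs ++ y ∷ ys ++ zs ,
  subst (_ ∈_) (sym (windows-∷ k≤)) (here (cong toSet (sym (take-all k _ (≤-reflexive length≡k))))) ,
  ≤-reflexive length≡k , x ∷ xs , zs , refl
  where
  length≡k : length (x ∷ xs ++ y ∷ ys ++ zs) ≡ k
  length≡k = ≤-antisym (≰⇒> k≰′) k≤

⊑-refl : {C : Hypergraph n k} → C ⊑ C
⊑-refl = (λ u∈ → u∈) , (λ _ e∈ → e∈)

⊑-trans : {C D E : Hypergraph n k} → C ⊑ D → D ⊑ E → C ⊑ E
⊑-trans (V⊆ , E⊆) (V⊆′ , E⊆′) = (λ u∈ → V⊆′ (V⊆ u∈)) , (λ e e∈ → E⊆′ e (E⊆ e e∈))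

module ClosedStretch
  {n k : ℕ} {C : Hypergraph n k} {ws : List (Fin n)}
  (ws⊆V : All (S._∈ vertices C) ws)
  (windows-unique : Unique (windows k ws))
  (edge⇔window : ∀ e → (e ∈ edges C) ⇔ (e ∈ windows k ws))
  {a : List (Fin n)} {x : Fin n} {b t : List (Fin n)}
  (ws≡ : ws ≡ a ++ (x ∷ b ++ [ x ]) ++ t)
  where

  stretch : List (Fin n)
  stretch = x ∷ b ++ [ x ]

  private
    block : ∃₂ λ P Q → windows k ws ≡ P ++ windows k stretch ++ Q
    block = let P , Q , eq = windows-++-infix a stretch t
            in  P , Q , trans (cong (windows k) ws≡) eq

    P = proj₁ block

    window⁺ : {e : Subset n} → e ∈ windows k stretch → e ∈ windows k ws
    window⁺ {e} e∈ = subst (e ∈_) (sym (proj₂ (proj₂ block))) (∈-++⁺ʳ P (∈-++⁺ˡ e∈))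

    edge⁺ : {e : Subset n} → e ∈ windows k stretch → e ∈ edges C
    edge⁺ e∈ = Equivalence.from (edge⇔window _) (window⁺ e∈)

    stretch-unique : Unique (windows k stretch)
    stretch-unique =
      Unique-++⁻ˡ (windows k stretch) (Unique-++⁻ʳ P (subst Unique (proj₂ (proj₂ block)) windows-unique))

  hypergraph : Hypergraph n k
  hypergraph = record
    { vertices      = toSet stretch
    ; edges         = windows k stretch
    ; edges-unique  = stretch-unique
    ; edges-uniform = All.tabulate (λ e∈ → All.lookup (edges-uniform C) (edge⁺ e∈))
    ; edges-in      = All.tabulate (∈-windows⇒⊆toSet stretch)
    }

  hypergraph-⊑ : hypergraph ⊑ C
  hypergraph-⊑ = V⊆ , (λ _ → edge⁺)
    where
    V⊆ : toSet stretch S.⊆ vertices C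
    V⊆ u∈ = All.lookup ws⊆V (subst (_ ∈_) (sym ws≡) (∈-++⁺ʳ a (∈-++⁺ˡ (∈-toSet⁻ stretch u∈))))

  isDefiningSeq : IsDefiningSeq hypergraph x (b ++ [ x ])
  isDefiningSeq =
    All.tabulate ∈-toSet⁺ , (λ u → ∈-toSet⁻ stretch) , lastOf-snoc x b x ,
    stretch-unique , (λ _ → mk⇔ (λ e∈ → e∈) (λ e∈ → e∈))

  private
    k≤length-ws : NonEmpty C → k ≤ length (a ++ stretch ++ t)
    k≤length-ws C≢∅ =
      let e , e∈ = ≢[]⇒∃∈ C≢∅
      in  subst (λ xs → k ≤ length xs) ws≡ (∈-windows⇒k≤length ws (Equivalence.to (edge⇔window e) e∈))

  k≤length-stretch : NonEmpty C → k ≤ length stretch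
  k≤length-stretch C≢∅ with k ≤? length stretch
  ... | yes k≤ = k≤
  ... | no k≰ with window-⊇-short-infix a x (b ++ [ x ]) t (<⇒≤ (≰⇒> k≰)) (k≤length-ws C≢∅)
  ...   | L , L∈ , L≤k , p , q , refl =
    ⊥-elim (<-irrefl refl (≤-trans (subst (_< length L) ∣L∣≡k ∣L∣<length) L≤k))
    where
    ∣L∣≡k : ∣ toSet L ∣ ≡ k
    ∣L∣≡k = All.lookup (edges-uniform C)
              (Equivalence.from (edge⇔window _) (subst (_ ∈_) (cong (windows k) (sym ws≡)) L∈))
    ∣L∣<length : ∣ toSet L ∣ < length L
    ∣L∣<length = ∣toSet∣<length p ((b ++ [ x ]) ++ q) (∈-++⁺ˡ (∈-++⁺ʳ b (here refl)))

  nonEmpty : NonEmpty C → NonEmpty hypergraph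
  nonEmpty C≢∅ ∅ with trans (sym (windows-∷ (k≤length-stretch C≢∅))) ∅
  ... | ()

semicycle⇒containsNSISemicycle : (C : Hypergraph n k) → IsSemicycle C → ContainsNSISemicycle C
semicycle⇒containsNSISemicycle C (C≢∅ , v , rest , seq@(V⊆ , _ , _ , windows-unique , edge⇔window))
  with unique⊎simpleLoop _≟_ (initOf v rest)
... | inj₁ init! = C , ⊑-refl {C = C} , C≢∅ , v , rest , seq , init!
... | inj₂ loop =
  hypergraph , hypergraph-⊑ , nonEmpty C≢∅ , base , inner ++ [ base ] , isDefiningSeq ,
  subst Unique (sym (initOf-snoc base inner base)) simple
  where
  open SimpleLoop loop
  v∷rest≡ : v ∷ rest ≡ before ++ (base ∷ inner ++ [ base ]) ++ after ++ [ lastOf v rest ]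
  v∷rest≡ = begin
    v ∷ rest                                              ≡⟨ ∷≡initOf++[lastOf] v rest ⟩
    initOf v rest ++ [ lastOf v rest ]                    ≡⟨ cong (_++ [ lastOf v rest ]) split ⟩
    (before ++ stretch ++ after) ++ [ lastOf v rest ]     ≡⟨ ++-assoc before _ _ ⟩
    before ++ (stretch ++ after) ++ [ lastOf v rest ]     ≡⟨ cong (before ++_) (++-assoc stretch after _) ⟩
    before ++ stretch ++ after ++ [ lastOf v rest ]       ∎
    where
    open ≡-Reasoning
    stretch = base ∷ inner ++ [ base ]
  open ClosedStretch {C = C} V⊆ windows-unique edge⇔window
         {a = before} {x = base} {b = inner} {t = after ++ [ lastOf v rest ]} v∷rest≡

mainTheorem4 : (n k : ℕ) (H : Hypergraph n k) →
    ¬ ContainsNSISemicycle H → ¬ ContainsSemicycle H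
mainTheorem4 n k H noNSI (C , C⊑H , C-semicycle)
  with D , D⊑C , D-nsi ← semicycle⇒containsNSISemicycle C C-semicycle =
  noNSI (D , ⊑-trans {C = D} {D = C} {E = H} D⊑C C⊑H , D-nsi)
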